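{- Let $g\ge2$ and $q$ be positive integers, and let $\#\mathcal F(g,q,3)$ denote the number of gapsets of genus $g$, depth $q$ and multiplicity $3$. Then $$\#\mathcal F(g,q,3)=\begin{cases}0, & \text{if } q<\frac g2,\\ 1, & \text{if } q=\frac g2,\\ 2, & \text{if } \frac{g+1}{2}\le q\le\frac{2g}{3},\\ 1, & \text{if } q=\frac{2g+1}{3},\\ 0, & \text{if } q>\frac{2g+1}{3}.\end{cases}$$
   Context: A gapset is a finite set $G\subset\mathbb N$ (positive integers) such that whenever $z\in G$ and $z=x+y$ with $x,y\in\mathbb N$, then $x\in G$ or $y\in G$. Its genus is $\#G$, its multiplicity is $m(G)=\min\{s\in\mathbb N_0\setminus G: s\ne0\}$, its conductor is $c(G)=\min\{s\in\mathbb N_0: s+n\notin G\ \forall n\in\mathbb N_0\}$, and its depth is $\lceil c(G)/m(G)\rceil$. -}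

module Defs where

open import Data.Nat using (ℕ; zero; suc; _+_; _*_; _≤_; _<_)
open import Data.List using (List; length)
open import Data.List.Membership.Propositional using (_∈_; _∉_)
open import Data.List.Relation.Unary.Linked using (Linked)
open import Data.List.Relation.Unary.All using (All)
open import Data.List.Relation.Unary.Unique.Propositional using (Unique)
open import Data.Product using (Σ; _×_)
open import Data.Sum using (_⊎_)
open import Relation.Binary.PropositionalEquality using (_≡_)

-- A finite subset of ℕ is represented canonically as a strictly increasing list.
-- A gapset: finite set of positive integers, closed under "z = x + y ⇒ x ∈ G or y ∈ G".
record Gapset (G : List ℕ) : Set where
  field
    sorted   : Linked _<_ G
    positive : All (λ z → 1 ≤ z) G
    closed   : ∀ z x y → z ∈ G → 1 ≤ x → 1 ≤ y → z ≡ x + y → x ∈ G ⊎ y ∈ G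

genus : List ℕ → ℕ
genus G = length G

IsMultiplicity : List ℕ → ℕ → Set
IsMultiplicity G m = (1 ≤ m) × (m ∉ G) × (∀ s → 1 ≤ s → s < m → s ∈ G)

IsConductor : List ℕ → ℕ → Set
IsConductor G c = (∀ n → (c + n) ∉ G) × (∀ s → (∀ n → (s + n) ∉ G) → c ≤ s)

-- depth = ⌈ c / m ⌉ : q is the ceiling of c/m iff q*m - m < c ≤ q*m
IsDepth : List ℕ → ℕ → Set
IsDepth G q = Σ ℕ λ m → Σ ℕ λ c →
  IsMultiplicity G m × IsConductor G c × (c ≤ q * m) × (q * m < c + m)

InF : ℕ → ℕ → ℕ → List ℕ → Set
InF g q m G = Gapset G × (genus G ≡ g) × IsMultiplicity G m × IsDepth G q

-- "#{G | P G} = n": there is a duplicate-free list enumerating exactly the G with P G,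
-- of length n (lists representing sets are canonical, so this counts sets).
HasCount : (List ℕ → Set) → ℕ → Set
HasCount P n = Σ (List (List ℕ)) λ L →
  Unique L × All P L × (∀ G → P G → G ∈ L) × (length L ≡ n)

{-# OPTIONS --safe #-}
-- A gapset G of multiplicity 3 contains 1 and 2 and no multiple of 3, and since 3 is a
-- non-gap, x + 3 ∈ G forces x ∈ G.  Hence G meets the residue classes 1 and 2 mod 3 in
-- initial segments, of lengths a and b say: G = {1, 4, …, 3a − 2} ∪ {2, 5, …, 3b − 1}.
-- Because non-gaps are closed under addition, such a set is a gapset exactly when
-- b ≤ 2a and a ≤ 2b + 1; its genus is a + b and its depth is max(a, b).  So 𝓕(g, q, 3)
-- consists of the sets for (a, b) = (q, g − q) and (g − q, q) that satisfy these two
-- inequalities, and the five cases of the count are read off from them.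
module Submission where

open import Defs
open import Data.Empty using (⊥; ⊥-elim)
open import Data.Fin using (Fin; toℕ)
open import Data.Fin.Patterns using (0F; 1F; 2F)
open import Data.Fin.Properties using (toℕ<n)
open import Data.List using (List; []; _∷_; map; length)
open import Data.List.Extrema.Nat using (max; xs≤max)
open import Data.List.Membership.Propositional using (_∈_; _∉_)
open import Data.List.Membership.Propositional.Properties using (∈-map⁺; ∈-map⁻)
open import Data.List.Properties using (length-map)
open import Data.List.Relation.Unary.All as All using ([]; _∷_)
open import Data.List.Relation.Unary.AllPairs using ([]; _∷_)
open import Data.List.Relation.Unary.Any using (here; there)
open import Data.List.Relation.Unary.Linked as Linked using (Linked; []; [-]; _∷_)
open import Data.List.Relation.Unary.Linked.Properties using (map⁺)
open import Data.Nat
  using (ℕ; zero; suc; pred; _+_; _*_; _∸_; _≤_; _<_; _⊔_; _≟_; _≤?_; z≤n; s≤s; s≤s⁻¹; z<s)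
open import Data.Nat.DivMod using (_divMod_; result)
open import Data.Nat.Properties
open import Data.Nat.Tactic.RingSolver using (solve-∀)
open import Algebra.Properties.CommutativeSemigroup +-commutativeSemigroup using (x∙yz≈y∙xz)
open import Data.List.Membership.DecPropositional _≟_ using (_∈?_)
open import Data.Product using (_×_; _,_; proj₁; proj₂; ∃-syntax; ∃₂)
open import Data.Sum as Sum using (_⊎_; inj₁; inj₂; [_,_]′)
open import Function using (_∘_; case_of_)
open import Relation.Binary.Definitions using (tri<; tri≈; tri>)
open import Relation.Binary.PropositionalEquality
open import Relation.Nullary using (yes; no)
open import Relation.Unary using (Decidable)

2*-≡-+ : ∀ n → 2 * n ≡ n + n
2*-≡-+ n = cong (n +_) (+-identityʳ n)

n≤2*n : ∀ n → n ≤ 2 * n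
n≤2*n n = m≤m+n n _

n≤1+2*n : ∀ n → n ≤ 1 + 2 * n
n≤1+2*n n = ≤-trans (n≤2*n n) (n≤1+n _)

3*≡2*+ : ∀ n → 3 * n ≡ 2 * n + n
3*≡2*+ n = +-comm n (2 * n)

2*-≤-+ : ∀ {a i j} → a ≤ i → a ≤ j → 2 * a ≤ i + j
2*-≤-+ {a} {i} {j} a≤i a≤j = subst (_≤ i + j) (sym (2*-≡-+ a)) (+-mono-≤ a≤i a≤j)

+≤2*⊔ : ∀ a b → a + b ≤ 2 * (a ⊔ b)
+≤2*⊔ a b = subst (a + b ≤_) (sym (2*-≡-+ (a ⊔ b))) (+-mono-≤ (m≤m⊔n a b) (m≤n⊔m a b))

3*-≤-2*+ : ∀ c x y → x ≤ c + 2 * y → 3 * x ≤ 2 * (x + y) + c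
3*-≤-2*+ c x y x≤c+2y = begin
  3 * x              ≡⟨⟩
  x + 2 * x          ≤⟨ +-monoˡ-≤ (2 * x) x≤c+2y ⟩
  c + 2 * y + 2 * x  ≡⟨ rhs c x y ⟩
  2 * (x + y) + c    ∎
  where
  open ≤-Reasoning
  rhs : ∀ c x y → c + 2 * y + 2 * x ≡ 2 * (x + y) + c
  rhs = solve-∀

suc<⇒<pred : ∀ {j k} → suc j < k → j < pred k
suc<⇒<pred (s≤s j<k) = j<k

<pred⇒suc< : ∀ {j k} → j < pred k → suc j < k
<pred⇒suc< {k = suc k} j<k = s≤s j<k

rows-+ : ∀ r i s j → (r + i * 3) + (s + j * 3) ≡ (r + s) + (i + j) * 3
rows-+ = solve-∀

sum-max-cases : ∀ {a b′ q b} → a + b′ ≡ q + b → a ⊔ b′ ≡ q → (a ≡ q × b′ ≡ b) ⊎ (a ≡ b × b′ ≡ q)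
sum-max-cases {a} {b′} {q} {b} sum max with ⊔-sel a b′
... | inj₁ a⊔b′≡a with trans (sym a⊔b′≡a) max
...   | refl = inj₁ (refl , +-cancelˡ-≡ a b′ b sum)
sum-max-cases {a} {b′} {q} {b} sum max | inj₂ a⊔b′≡b′ with trans (sym a⊔b′≡b′) max
...   | refl = inj₂ (+-cancelˡ-≡ b′ a b (trans (+-comm b′ a) sum) , refl)

-- Initial segments and strictly sorted lists

module _ {P : ℕ → Set} (P-pred : ∀ {j} → P (suc j) → P j) where

  P-downward : ∀ {j n} → j ≤ n → P n → P j
  P-downward {n = zero}  z≤n Pn = Pn
  P-downward {n = suc n} j≤n Pn with m≤n⇒m<n∨m≡n j≤n
  ... | inj₁ j<1+n = P-downward (s≤s⁻¹ j<1+n) (P-pred Pn)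
  ... | inj₂ refl  = Pn

  downward-closed⇒initial-segment : Decidable P → ∀ B → (∀ {j} → P j → j < B) →
    ∃[ k ] (∀ {j} → P j → j < k) × (∀ {j} → j < k → P j)
  downward-closed⇒initial-segment P? zero    <B = 0 , <B , λ ()
  downward-closed⇒initial-segment P? (suc B) <B with P? B
  ... | yes PB = suc B , <B , λ j<1+B → P-downward (s≤s⁻¹ j<1+B) PB
  ... | no ¬PB = downward-closed⇒initial-segment P? B λ {j} Pj →
    ≤∧≢⇒< (s≤s⁻¹ (<B Pj)) λ { refl → ¬PB Pj }

head<tail : ∀ {x xs z} → Linked _<_ (x ∷ xs) → z ∈ xs → x < z
head<tail (x<y ∷ _)      (here refl) = x<y
head<tail (x<y ∷ sorted) (there z∈)  = <-trans x<y (head<tail sorted z∈)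

sorted-heads-≡ : ∀ {x xs y ys} → Linked _<_ (x ∷ xs) → Linked _<_ (y ∷ ys) →
  x ∈ y ∷ ys → y ∈ x ∷ xs → x ≡ y
sorted-heads-≡ _  _  (here x≡y)   _            = x≡y
sorted-heads-≡ _  _  (there _)    (here y≡x)   = sym y≡x
sorted-heads-≡ sx sy (there x∈ys) (there y∈xs) = ⊥-elim (<-asym (head<tail sx y∈xs) (head<tail sy x∈ys))

sorted-tail-⊆ : ∀ {x xs ys} → Linked _<_ (x ∷ xs) →
  (∀ {z} → z ∈ x ∷ xs → z ∈ x ∷ ys) → ∀ {z} → z ∈ xs → z ∈ ys
sorted-tail-⊆ sorted ⊆ z∈xs with ⊆ (there z∈xs)
... | here refl  = ⊥-elim (<-irrefl refl (head<tail sorted z∈xs))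
... | there z∈ys = z∈ys

strictly-sorted-≡ : ∀ {xs ys} → Linked _<_ xs → Linked _<_ ys →
  (∀ {z} → z ∈ xs → z ∈ ys) → (∀ {z} → z ∈ ys → z ∈ xs) → xs ≡ ys
strictly-sorted-≡ {[]}     {[]}     _  _  _  _ = refl
strictly-sorted-≡ {[]}     {y ∷ _}  _  _  _  ⊇ with ⊇ (here refl)
... | ()
strictly-sorted-≡ {x ∷ _}  {[]}     _  _  ⊆  _ with ⊆ (here refl)
... | ()
strictly-sorted-≡ {x ∷ xs} {y ∷ ys} sx sy ⊆ ⊇ with sorted-heads-≡ sx sy (⊆ (here refl)) (⊇ (here refl))
... | refl = cong (x ∷_)
  (strictly-sorted-≡ (Linked.tail sx) (Linked.tail sy) (sorted-tail-⊆ sx ⊆) (sorted-tail-⊆ sy ⊇))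

-- Gapsets

module GapsetProperties {G : List ℕ} (gapset : Gapset G) where
  open Gapset gapset

  0∉ : 0 ∉ G
  0∉ 0∈G with All.lookup positive 0∈G
  ... | ()

  ∉-+ : ∀ {x y} → x ∉ G → y ∉ G → x + y ∉ G
  ∉-+ {zero}          _   y∉G = y∉G
  ∉-+ {suc x} {zero}  x∉G _   = x∉G ∘ subst (_∈ G) (+-identityʳ (suc x))
  ∉-+ {suc x} {suc y} x∉G y∉G x+y∈G =
    [ x∉G , y∉G ]′ (closed _ (suc x) (suc y) x+y∈G z<s z<s refl)

  *-∉ : ∀ {m} → m ∉ G → ∀ j → j * m ∉ G
  *-∉ m∉G zero    = 0∉
  *-∉ m∉G (suc j) = ∉-+ m∉G (*-∉ m∉G j)

  +-cancelˡ-∈ : ∀ {m x} → m ∉ G → m + x ∈ G → x ∈ G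
  +-cancelˡ-∈ {x = x} m∉G m+x∈G with x ∈? G
  ... | yes x∈G = x∈G
  ... | no  x∉G = ⊥-elim (∉-+ m∉G x∉G m+x∈G)

closed-if-∉-+ : ∀ {L} → (∀ {x y} → x ∉ L → y ∉ L → x + y ∉ L) →
  ∀ z x y → z ∈ L → 1 ≤ x → 1 ≤ y → z ≡ x + y → x ∈ L ⊎ y ∈ L
closed-if-∉-+ {L} ∉-closed z x y z∈L _ _ refl with x ∈? L | y ∈? L
... | yes x∈L | _       = inj₁ x∈L
... | no  _   | yes y∈L = inj₂ y∈L
... | no  x∉L | no  y∉L = ⊥-elim (∉-closed x∉L y∉L z∈L)

IsMultiplicity-unique : ∀ {G m m′} → IsMultiplicity G m → IsMultiplicity G m′ → m ≡ m′
IsMultiplicity-unique {m = m} {m′} (1≤m , m∉G , below) (1≤m′ , m′∉G , below′) with <-cmp m m′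
... | tri< m<m′ _ _ = ⊥-elim (m∉G (below′ m 1≤m m<m′))
... | tri≈ _ m≡m′ _ = m≡m′
... | tri> _ _ m′<m = ⊥-elim (m′∉G (below m′ 1≤m′ m′<m))

IsConductor-unique : ∀ {G c c′} → IsConductor G c → IsConductor G c′ → c ≡ c′
IsConductor-unique (beyond , least) (beyond′ , least′) = ≤-antisym (least _ beyond′) (least′ _ beyond)

ceiling-≤ : ∀ {c m q q′} → c ≤ q * m → q′ * m < c + m → q′ ≤ q
ceiling-≤ {c} {m} {q} {q′} c≤qm q′m<c+m = s≤s⁻¹ (*-cancelʳ-< m q′ (suc q) (begin-strict
  q′ * m     <⟨ q′m<c+m ⟩
  c + m      ≤⟨ +-monoˡ-≤ m c≤qm ⟩
  q * m + m  ≡⟨ +-comm (q * m) m ⟩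
  suc q * m  ∎))
  where open ≤-Reasoning

IsDepth-unique : ∀ {G q q′} → IsDepth G q → IsDepth G q′ → q ≡ q′
IsDepth-unique (_ , _ , mult , cond , c≤qm , qm<c+m) (_ , _ , mult′ , cond′ , c′≤q′m′ , q′m′<c′+m′)
  with IsMultiplicity-unique mult mult′ | IsConductor-unique cond cond′
... | refl | refl = ≤-antisym (ceiling-≤ c′≤q′m′ qm<c+m) (ceiling-≤ c≤qm q′m′<c′+m′)

conductor-suc-max : ∀ {G t} → t ∈ G → (∀ {x} → x ∈ G → x ≤ t) → IsConductor G (suc t)
conductor-suc-max {G} {t} t∈G ≤t = beyond , least
  where
  beyond : ∀ n → suc t + n ∉ G
  beyond n t+1+n∈G = <⇒≱ (s≤s (m≤m+n t n)) (≤t t+1+n∈G)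
  least : ∀ s → (∀ n → s + n ∉ G) → suc t ≤ s
  least s beyond-s = ≰⇒> λ s≤t → beyond-s (t ∸ s) (subst (_∈ G) (sym (m+[n∸m]≡n s≤t)) t∈G)

-- gaps₃ a b = {1, 4, …, 3a − 2} ∪ {2, 5, …, 3b − 1}
gaps₃ : ℕ → ℕ → List ℕ
gaps₃ zero    zero    = []
gaps₃ zero    (suc b) = 2 ∷ map (3 +_) (gaps₃ zero b)
gaps₃ (suc a) zero    = 1 ∷ map (3 +_) (gaps₃ a zero)
gaps₃ (suc a) (suc b) = 1 ∷ 2 ∷ map (3 +_) (gaps₃ a b)

-- The residue class r mod 3 of gaps₃ a b is {r + j * 3 ∣ j < rowBound r a b}.
rowBound : Fin 3 → ℕ → ℕ → ℕ
rowBound 0F _ _ = 0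
rowBound 1F a _ = a
rowBound 2F _ b = b

∈-map-3+⁻ : ∀ {x L} → 3 + x ∈ map (3 +_) L → x ∈ L
∈-map-3+⁻ 3+x∈ with ∈-map⁻ (3 +_) 3+x∈
... | _ , x∈L , refl = x∈L

toℕ∉map-3+ : ∀ (r : Fin 3) {L} → toℕ r ∉ map (3 +_) L
toℕ∉map-3+ r r∈ with ∈-map⁻ (3 +_) r∈
... | y , _ , r≡3+y = <⇒≱ (toℕ<n r) (subst (3 ≤_) (sym r≡3+y) (m≤m+n 3 y))

∈-gaps₃-shift⁻ : ∀ a b {x} → 3 + x ∈ gaps₃ a b → x ∈ gaps₃ (pred a) (pred b)
∈-gaps₃-shift⁻ zero    zero    ()
∈-gaps₃-shift⁻ zero    (suc b) (there 3+x∈)         = ∈-map-3+⁻ 3+x∈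
∈-gaps₃-shift⁻ (suc a) zero    (there 3+x∈)         = ∈-map-3+⁻ 3+x∈
∈-gaps₃-shift⁻ (suc a) (suc b) (there (there 3+x∈)) = ∈-map-3+⁻ 3+x∈

∈-gaps₃-shift⁺ : ∀ a b {x} → x ∈ gaps₃ (pred a) (pred b) → 3 + x ∈ gaps₃ a b
∈-gaps₃-shift⁺ zero    zero    ()
∈-gaps₃-shift⁺ zero    (suc b) x∈ = there (∈-map⁺ (3 +_) x∈)
∈-gaps₃-shift⁺ (suc a) zero    x∈ = there (∈-map⁺ (3 +_) x∈)
∈-gaps₃-shift⁺ (suc a) (suc b) x∈ = there (there (∈-map⁺ (3 +_) x∈))

∈-gaps₃⁺ : ∀ r j {a b} → j < rowBound r a b → toℕ r + j * 3 ∈ gaps₃ a b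
∈-gaps₃⁺ 1F zero    {suc a} {zero}  _ = here refl
∈-gaps₃⁺ 1F zero    {suc a} {suc b} _ = here refl
∈-gaps₃⁺ 2F zero    {zero}  {suc b} _ = here refl
∈-gaps₃⁺ 2F zero    {suc a} {suc b} _ = there (here refl)
∈-gaps₃⁺ 1F (suc j) {a}     {b}     j<a = ∈-gaps₃-shift⁺ a b (∈-gaps₃⁺ 1F j (suc<⇒<pred j<a))
∈-gaps₃⁺ 2F (suc j) {a}     {b}     j<b = ∈-gaps₃-shift⁺ a b (∈-gaps₃⁺ 2F j (suc<⇒<pred j<b))

∈-gaps₃⁻ : ∀ r j {a b} → toℕ r + j * 3 ∈ gaps₃ a b → j < rowBound r a b
∈-gaps₃⁻ 0F zero    {zero}  {suc b} (there 0∈)         = ⊥-elim (toℕ∉map-3+ 0F 0∈)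
∈-gaps₃⁻ 0F zero    {suc a} {zero}  (there 0∈)         = ⊥-elim (toℕ∉map-3+ 0F 0∈)
∈-gaps₃⁻ 0F zero    {suc a} {suc b} (there (there 0∈)) = ⊥-elim (toℕ∉map-3+ 0F 0∈)
∈-gaps₃⁻ 1F zero    {suc a}         _                  = z<s
∈-gaps₃⁻ 1F zero    {zero}  {suc b} (there 1∈)         = ⊥-elim (toℕ∉map-3+ 1F 1∈)
∈-gaps₃⁻ 2F zero    {b = suc b}     _                  = z<s
∈-gaps₃⁻ 2F zero    {suc a} {zero}  (there 2∈)         = ⊥-elim (toℕ∉map-3+ 2F 2∈)
∈-gaps₃⁻ 0F (suc j) {a}     {b}     x∈ = <pred⇒suc< (∈-gaps₃⁻ 0F j (∈-gaps₃-shift⁻ a b x∈))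
∈-gaps₃⁻ 1F (suc j) {a}     {b}     x∈ = <pred⇒suc< (∈-gaps₃⁻ 1F j (∈-gaps₃-shift⁻ a b x∈))
∈-gaps₃⁻ 2F (suc j) {a}     {b}     x∈ = <pred⇒suc< (∈-gaps₃⁻ 2F j (∈-gaps₃-shift⁻ a b x∈))

∷-map-3+-sorted : ∀ {x L} → x < 3 → Linked _<_ L → Linked _<_ (x ∷ map (3 +_) L)
∷-map-3+-sorted {L = []}    _   _       = [-]
∷-map-3+-sorted {L = y ∷ _} x<3 sorted =
  ≤-trans x<3 (m≤m+n 3 y) ∷ map⁺ (Linked.map (+-monoʳ-< 3) sorted)

gaps₃-sorted : ∀ a b → Linked _<_ (gaps₃ a b)
gaps₃-sorted zero    zero    = []
gaps₃-sorted zero    (suc b) = ∷-map-3+-sorted (n<1+n 2) (gaps₃-sorted zero b)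
gaps₃-sorted (suc a) zero    = ∷-map-3+-sorted (toℕ<n 1F) (gaps₃-sorted a zero)
gaps₃-sorted (suc a) (suc b) = n<1+n 1 ∷ ∷-map-3+-sorted (n<1+n 2) (gaps₃-sorted a b)

gaps₃-length : ∀ a b → length (gaps₃ a b) ≡ a + b
gaps₃-length zero    zero    = refl
gaps₃-length zero    (suc b) = cong suc (trans (length-map (3 +_) (gaps₃ zero b)) (gaps₃-length zero b))
gaps₃-length (suc a) zero    = cong suc (trans (length-map (3 +_) (gaps₃ a zero)) (gaps₃-length a zero))
gaps₃-length (suc a) (suc b) = cong suc (begin
  suc (length (map (3 +_) (gaps₃ a b))) ≡⟨ cong suc (length-map (3 +_) (gaps₃ a b)) ⟩
  suc (length (gaps₃ a b))              ≡⟨ cong suc (gaps₃-length a b) ⟩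
  suc (a + b)                           ≡⟨ +-suc a b ⟨
  a + suc b                             ∎)
  where open ≡-Reasoning

∉-gaps₃⇒≤ : ∀ r {j a b} → toℕ r + j * 3 ∉ gaps₃ a b → rowBound r a b ≤ j
∉-gaps₃⇒≤ r x∉ = ≮⇒≥ (x∉ ∘ ∈-gaps₃⁺ r _)

-- The carry of r + s into the next multiple of 3 is visible definitionally:
-- 1 + 2 + k * 3 is suc k * 3 and 2 + 2 + k * 3 is 1 + suc k * 3.
rows-∉-+ : ∀ {a b} → b ≤ 2 * a → a ≤ 1 + 2 * b → ∀ r s {i j} →
  rowBound r a b ≤ i → rowBound s a b ≤ j → (toℕ r + toℕ s) + (i + j) * 3 ∉ gaps₃ a b
rows-∉-+ _ _ 0F 0F {i} {j} _ _ x∈ = n≮0 (∈-gaps₃⁻ 0F (i + j) x∈)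
rows-∉-+ _ _ 0F 1F {i} {j} _ a≤j x∈ = <⇒≱ (∈-gaps₃⁻ 1F (i + j) x∈) (≤-trans a≤j (m≤n+m j i))
rows-∉-+ _ _ 0F 2F {i} {j} _ b≤j x∈ = <⇒≱ (∈-gaps₃⁻ 2F (i + j) x∈) (≤-trans b≤j (m≤n+m j i))
rows-∉-+ _ _ 1F 0F {i} {j} a≤i _ x∈ = <⇒≱ (∈-gaps₃⁻ 1F (i + j) x∈) (≤-trans a≤i (m≤m+n i j))
rows-∉-+ _ _ 2F 0F {i} {j} b≤i _ x∈ = <⇒≱ (∈-gaps₃⁻ 2F (i + j) x∈) (≤-trans b≤i (m≤m+n i j))
rows-∉-+ b≤2a _ 1F 1F {i} {j} a≤i a≤j x∈ =
  <⇒≱ (∈-gaps₃⁻ 2F (i + j) x∈) (≤-trans b≤2a (2*-≤-+ a≤i a≤j))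
rows-∉-+ _ _ 1F 2F {i} {j} _ _ x∈ = n≮0 (∈-gaps₃⁻ 0F (suc (i + j)) x∈)
rows-∉-+ _ _ 2F 1F {i} {j} _ _ x∈ = n≮0 (∈-gaps₃⁻ 0F (suc (i + j)) x∈)
rows-∉-+ _ a≤1+2b 2F 2F {i} {j} b≤i b≤j x∈ =
  <⇒≱ (∈-gaps₃⁻ 1F (suc (i + j)) x∈) (≤-trans a≤1+2b (s≤s (2*-≤-+ b≤i b≤j)))

gaps₃-∉-+ : ∀ {a b} → b ≤ 2 * a → a ≤ 1 + 2 * b →
  ∀ {x y} → x ∉ gaps₃ a b → y ∉ gaps₃ a b → x + y ∉ gaps₃ a b
gaps₃-∉-+ {a} {b} b≤2a a≤1+2b {x} {y} x∉ y∉ with x divMod 3 | y divMod 3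
... | result i r refl | result j s refl =
  rows-∉-+ b≤2a a≤1+2b r s {i} {j} (∉-gaps₃⇒≤ r x∉) (∉-gaps₃⇒≤ s y∉)
  ∘ subst (_∈ gaps₃ a b) (rows-+ (toℕ r) i (toℕ s) j)

record Admissible (a b : ℕ) : Set where
  constructor admissible
  field
    1≤a    : 1 ≤ a
    1≤b    : 1 ≤ b
    b≤2a   : b ≤ 2 * a
    a≤1+2b : a ≤ 1 + 2 * b

gaps₃-Gapset : ∀ {a b} → b ≤ 2 * a → a ≤ 1 + 2 * b → Gapset (gaps₃ a b)
gaps₃-Gapset {a} {b} b≤2a a≤1+2b = record
  { sorted   = gaps₃-sorted a b
  ; positive = All.tabulate positive
  ; closed   = closed-if-∉-+ (gaps₃-∉-+ b≤2a a≤1+2b)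
  }
  where
  positive : ∀ {x} → x ∈ gaps₃ a b → 1 ≤ x
  positive {zero}  0∈ = ⊥-elim (n≮0 (∈-gaps₃⁻ 0F 0 0∈))
  positive {suc x} _  = z<s

gaps₃-multiplicity : ∀ {a b} → 1 ≤ a → 1 ≤ b → IsMultiplicity (gaps₃ a b) 3
gaps₃-multiplicity {a} {b} 1≤a 1≤b = z<s , n≮0 ∘ ∈-gaps₃⁻ 0F 1 , below
  where
  below : ∀ s → 1 ≤ s → s < 3 → s ∈ gaps₃ a b
  below 1 _ _ = ∈-gaps₃⁺ 1F 0 1≤a
  below 2 _ _ = ∈-gaps₃⁺ 2F 0 1≤b
  below (suc (suc (suc _))) _ (s≤s (s≤s (s≤s ())))

gaps₃-conductorˡ : ∀ {a b} → b ≤ a → IsConductor (gaps₃ (suc a) b) (2 + a * 3)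
gaps₃-conductorˡ {a} {b} b≤a = conductor-suc-max (∈-gaps₃⁺ 1F a (n<1+n a)) ≤top
  where
  ≤top : ∀ {x} → x ∈ gaps₃ (suc a) b → x ≤ 1 + a * 3
  ≤top {x} x∈ with x divMod 3
  ... | result j 0F refl = ⊥-elim (n≮0 (∈-gaps₃⁻ 0F j x∈))
  ... | result j 1F refl = s≤s (*-monoˡ-≤ 3 (s≤s⁻¹ (∈-gaps₃⁻ 1F j x∈)))
  ... | result j 2F refl =
    ≤-trans (n≤1+n _) (≤-trans (*-monoˡ-≤ 3 (≤-trans (∈-gaps₃⁻ 2F j x∈) b≤a)) (n≤1+n _))

gaps₃-conductorʳ : ∀ {a b} → a ≤ suc b → IsConductor (gaps₃ a (suc b)) (suc b * 3)
gaps₃-conductorʳ {a} {b} a≤1+b = conductor-suc-max (∈-gaps₃⁺ 2F b (n<1+n b)) ≤top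
  where
  ≤top : ∀ {x} → x ∈ gaps₃ a (suc b) → x ≤ 2 + b * 3
  ≤top {x} x∈ with x divMod 3
  ... | result j 0F refl = ⊥-elim (n≮0 (∈-gaps₃⁻ 0F j x∈))
  ... | result j 1F refl =
    s≤s (≤-trans (*-monoˡ-≤ 3 (s≤s⁻¹ (≤-trans (∈-gaps₃⁻ 1F j x∈) a≤1+b))) (n≤1+n _))
  ... | result j 2F refl = s≤s (s≤s (*-monoˡ-≤ 3 (s≤s⁻¹ (∈-gaps₃⁻ 2F j x∈))))

gaps₃-depth : ∀ {a b} → 1 ≤ a → 1 ≤ b → IsDepth (gaps₃ a b) (a ⊔ b)
gaps₃-depth {suc a} {suc b} 1≤a 1≤b with a ≤? b
... | yes a≤b = subst (IsDepth _) (sym (m≤n⇒m⊔n≡n (s≤s a≤b)))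
  (3 , suc b * 3 , gaps₃-multiplicity 1≤a 1≤b , gaps₃-conductorʳ (s≤s a≤b) , ≤-refl , m<m+n _ z<s)
... | no  a≰b = subst (IsDepth _) (sym (m≥n⇒m⊔n≡m (<⇒≤ (s≤s b<a))))
  (3 , 2 + a * 3 , gaps₃-multiplicity 1≤a 1≤b , gaps₃-conductorˡ b<a , n≤1+n _ ,
   ≤-trans (n≤1+n _) (≤-reflexive (+-comm 3 (2 + a * 3))))
  where
  b<a : b < a
  b<a = ≰⇒> a≰b

gaps₃-InF : ∀ {a b g q} → Admissible a b → a + b ≡ g → a ⊔ b ≡ q → InF g q 3 (gaps₃ a b)
gaps₃-InF {a} {b} (admissible 1≤a 1≤b b≤2a a≤1+2b) refl refl =
  gaps₃-Gapset b≤2a a≤1+2b , gaps₃-length a b , gaps₃-multiplicity 1≤a 1≤b , gaps₃-depth 1≤a 1≤b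

gaps₃-≡⇒≤ : ∀ {a b a′ b′} → gaps₃ a b ≡ gaps₃ a′ b′ → a ≤ a′
gaps₃-≡⇒≤ {a} {b} {a′} eq =
  ≮⇒≥ λ a′<a → <-irrefl refl (∈-gaps₃⁻ 1F a′ (subst (_ ∈_) eq (∈-gaps₃⁺ 1F a′ {a} {b} a′<a)))

-- Gapsets of multiplicity 3

module Multiplicity3 {G : List ℕ} (gapset : Gapset G) (mult3 : IsMultiplicity G 3) where
  open Gapset gapset using (sorted)
  open GapsetProperties gapset

  private
    3∉G : 3 ∉ G
    3∉G = proj₁ (proj₂ mult3)

  InRow : Fin 3 → ℕ → Set
  InRow r j = toℕ r + j * 3 ∈ G

  InRow-pred : ∀ r {j} → InRow r (suc j) → InRow r j
  InRow-pred r {j} = +-cancelˡ-∈ 3∉G ∘ subst (_∈ G) (x∙yz≈y∙xz (toℕ r) 3 (j * 3))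

  InRow-bounded : ∀ r {j} → InRow r j → j < suc (max 0 G)
  InRow-bounded r {j} x∈G = s≤s (begin
    j             ≤⟨ m≤m*n j 3 ⟩
    j * 3         ≤⟨ m≤n+m (j * 3) (toℕ r) ⟩
    toℕ r + j * 3 ≤⟨ All.lookup (xs≤max 0 G) x∈G ⟩
    max 0 G       ∎)
    where open ≤-Reasoning

  row-segment : ∀ r → ∃[ k ] (∀ {j} → InRow r j → j < k) × (∀ {j} → j < k → InRow r j)
  row-segment r = downward-closed⇒initial-segment (λ {j} → InRow-pred r {j})
    (λ j → toℕ r + j * 3 ∈? G) (suc (max 0 G)) (InRow-bounded r)

  k₁ k₂ : ℕ
  k₁ = proj₁ (row-segment 1F)
  k₂ = proj₁ (row-segment 2F)

  InRow⁻ : ∀ r {j} → InRow r j → j < rowBound r k₁ k₂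
  InRow⁻ 0F {j} = ⊥-elim ∘ *-∉ 3∉G j
  InRow⁻ 1F     = proj₁ (proj₂ (row-segment 1F))
  InRow⁻ 2F     = proj₁ (proj₂ (row-segment 2F))

  InRow⁺ : ∀ r {j} → j < rowBound r k₁ k₂ → InRow r j
  InRow⁺ 1F = proj₂ (proj₂ (row-segment 1F))
  InRow⁺ 2F = proj₂ (proj₂ (row-segment 2F))

  G≡gaps₃ : G ≡ gaps₃ k₁ k₂
  G≡gaps₃ = strictly-sorted-≡ sorted (gaps₃-sorted k₁ k₂) G⊆gaps₃ gaps₃⊆G
    where
    G⊆gaps₃ : ∀ {x} → x ∈ G → x ∈ gaps₃ k₁ k₂
    G⊆gaps₃ {x} x∈G with x divMod 3
    ... | result j r refl = ∈-gaps₃⁺ r j (InRow⁻ r x∈G)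
    gaps₃⊆G : ∀ {x} → x ∈ gaps₃ k₁ k₂ → x ∈ G
    gaps₃⊆G {x} x∈ with x divMod 3
    ... | result j r refl = InRow⁺ r (∈-gaps₃⁻ r j x∈)

  -- Were k₂ > 2k₁, the element 2 + 2k₁ * 3 of G would be twice the non-gap 1 + k₁ * 3;
  -- symmetrically for k₁ > 1 + 2k₂.
  gaps₃-form : ∃₂ λ a b → Admissible a b × G ≡ gaps₃ a b
  gaps₃-form = k₁ , k₂ , admissible (InRow⁻ 1F 1∈G) (InRow⁻ 2F 2∈G) k₂≤2k₁ k₁≤1+2k₂ , G≡gaps₃
    where
    1∈G : 1 ∈ G
    1∈G = proj₂ (proj₂ mult3) 1 z<s (s≤s (s≤s z≤n))
    2∈G : 2 ∈ G
    2∈G = proj₂ (proj₂ mult3) 2 z<s ≤-refl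
    row-end∉G : ∀ r → InRow r (rowBound r k₁ k₂) → ⊥
    row-end∉G r = <-irrefl refl ∘ InRow⁻ r
    double₁ : ∀ k → 2 + (2 * k) * 3 ≡ (1 + k * 3) + (1 + k * 3)
    double₁ = solve-∀
    double₂ : ∀ k → 1 + (1 + 2 * k) * 3 ≡ (2 + k * 3) + (2 + k * 3)
    double₂ = solve-∀
    k₂≤2k₁ : k₂ ≤ 2 * k₁
    k₂≤2k₁ = ≮⇒≥ λ 2k₁<k₂ →
      ∉-+ (row-end∉G 1F) (row-end∉G 1F) (subst (_∈ G) (double₁ k₁) (InRow⁺ 2F 2k₁<k₂))
    k₁≤1+2k₂ : k₁ ≤ 1 + 2 * k₂
    k₁≤1+2k₂ = ≮⇒≥ λ 1+2k₂<k₁ →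
      ∉-+ (row-end∉G 2F) (row-end∉G 2F) (subst (_∈ G) (double₂ k₂) (InRow⁺ 1F 1+2k₂<k₁))

gaps₃-form⇒classification : ∀ {g q G} → genus G ≡ g → IsDepth G q →
  (∃₂ λ a b → Admissible a b × G ≡ gaps₃ a b) →
  ∃₂ λ a b → Admissible a b × a + b ≡ g × a ⊔ b ≡ q × G ≡ gaps₃ a b
gaps₃-form⇒classification genus≡g depth (a , b , adm@(admissible 1≤a 1≤b _ _) , G≡gaps₃) =
  a , b , adm , trans (sym (gaps₃-length a b)) (trans (cong length (sym G≡gaps₃)) genus≡g) ,
  IsDepth-unique (subst (λ L → IsDepth L (a ⊔ b)) (sym G≡gaps₃) (gaps₃-depth 1≤a 1≤b)) depth , G≡gaps₃

InF₃-classification : ∀ {g q G} → InF g q 3 G →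
  ∃₂ λ a b → Admissible a b × a + b ≡ g × a ⊔ b ≡ q × G ≡ gaps₃ a b
InF₃-classification (gapset , genus≡g , mult3 , depth) =
  gaps₃-form⇒classification genus≡g depth (Multiplicity3.gaps₃-form gapset mult3)

InF₃-pairs : ∀ {q b G} → InF (q + b) q 3 G →
  (Admissible q b × G ≡ gaps₃ q b) ⊎ (Admissible b q × G ≡ gaps₃ b q)
InF₃-pairs = pairs ∘ InF₃-classification
  where
  pairs : ∀ {q b G} → (∃₂ λ a b′ → Admissible a b′ × a + b′ ≡ q + b × a ⊔ b′ ≡ q × G ≡ gaps₃ a b′) →
    (Admissible q b × G ≡ gaps₃ q b) ⊎ (Admissible b q × G ≡ gaps₃ b q)
  pairs (a , b′ , adm , sum , max , G≡gaps₃) with sum-max-cases {a} {b′} sum max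
  ... | inj₁ (refl , refl) = inj₁ (adm , G≡gaps₃)
  ... | inj₂ (refl , refl) = inj₂ (adm , G≡gaps₃)

-- Counting

Admissible⇒3[a⊔b]≤2[a+b]+1 : ∀ {a b} → Admissible a b → 3 * (a ⊔ b) ≤ 2 * (a + b) + 1
Admissible⇒3[a⊔b]≤2[a+b]+1 {a} {b} (admissible _ _ b≤2a a≤1+2b) with ⊔-sel a b
... | inj₁ a⊔b≡a rewrite a⊔b≡a = 3*-≤-2*+ 1 a b a≤1+2b
... | inj₂ a⊔b≡b rewrite a⊔b≡b | +-comm a b =
  ≤-trans (3*-≤-2*+ 0 b a b≤2a) (+-monoʳ-≤ (2 * (b + a)) z≤n)

HasCount-0 : ∀ {P : List ℕ → Set} → (∀ {G} → P G → ⊥) → HasCount P 0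
HasCount-0 ¬P = [] , [] , [] , (λ _ → ⊥-elim ∘ ¬P) , refl

HasCount-1 : ∀ {P : List ℕ → Set} {G₁} → P G₁ → (∀ {G} → P G → G ≡ G₁) → HasCount P 1
HasCount-1 {G₁ = G₁} P₁ only = G₁ ∷ [] , [] ∷ [] , P₁ ∷ [] , (λ _ → here ∘ only) , refl

HasCount-2 : ∀ {P : List ℕ → Set} {G₁ G₂} → G₁ ≢ G₂ → P G₁ → P G₂ →
  (∀ {G} → P G → G ≡ G₁ ⊎ G ≡ G₂) → HasCount P 2
HasCount-2 {G₁ = G₁} {G₂} G₁≢G₂ P₁ P₂ only =
  G₁ ∷ G₂ ∷ [] , (G₁≢G₂ ∷ []) ∷ [] ∷ [] , P₁ ∷ P₂ ∷ [] , (λ _ → [ here , there ∘ here ]′ ∘ only) , refl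

3q≤2g⇒q≤g : ∀ {q g} → 3 * q ≤ 2 * g → q ≤ g
3q≤2g⇒q≤g {q} {g} 3q≤2g = *-cancelˡ-≤ 3 (≤-trans 3q≤2g (*-monoˡ-≤ g (n≤1+n 2)))

q+b<2q⇒b<q : ∀ {q b} → q + b + 1 ≤ 2 * q → b < q
q+b<2q⇒b<q {q} {b} = +-cancelˡ-≤ q (suc b) q ∘ subst₂ _≤_ q+b+1≡q+[1+b] (2*-≡-+ q)
  where
  q+b+1≡q+[1+b] : q + b + 1 ≡ q + suc b
  q+b+1≡q+[1+b] = trans (+-assoc q b 1) (cong (q +_) (+-comm b 1))

3q≤2[q+b]⇒q≤2b : ∀ {q b} → 3 * q ≤ 2 * (q + b) → q ≤ 2 * b
3q≤2[q+b]⇒q≤2b {q} {b} = +-cancelˡ-≤ (2 * q) q (2 * b) ∘ subst₂ _≤_ (3*≡2*+ q) (*-distribˡ-+ 2 q b)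

3q≡2[q+b]+1⇒q≡1+2b : ∀ {q b} → 3 * q ≡ 2 * (q + b) + 1 → q ≡ 1 + 2 * b
3q≡2[q+b]+1⇒q≡1+2b {q} {b} 3q≡2[q+b]+1 =
  +-cancelˡ-≡ (2 * q) q (1 + 2 * b) (trans (sym (3*≡2*+ q)) (trans 3q≡2[q+b]+1 (regroup q b)))
  where
  regroup : ∀ q b → 2 * (q + b) + 1 ≡ 2 * q + (1 + 2 * b)
  regroup = solve-∀

3q≡2g+1⇒q≤g : ∀ {q g} → 1 ≤ g → 3 * q ≡ 2 * g + 1 → q ≤ g
3q≡2g+1⇒q≤g {q} {g} 1≤g 3q≡2g+1 = *-cancelˡ-≤ 3 (begin
  3 * q      ≡⟨ 3q≡2g+1 ⟩
  2 * g + 1  ≤⟨ +-monoʳ-≤ (2 * g) 1≤g ⟩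
  2 * g + g  ≡⟨ 3*≡2*+ g ⟨
  3 * g      ∎)
  where open ≤-Reasoning

count-2q<g : ∀ {g q} → 2 * q < g → HasCount (InF g q 3) 0
count-2q<g {g} {q} 2q<g = HasCount-0 λ inF →
  let a , b , _ , a+b≡g , a⊔b≡q , _ = InF₃-classification {g} {q} inF
  in <⇒≱ 2q<g (subst₂ (λ s m → s ≤ 2 * m) a+b≡g a⊔b≡q (+≤2*⊔ a b))

count-2q≡g : ∀ {g q} → 1 ≤ q → 2 * q ≡ g → HasCount (InF g q 3) 1
count-2q≡g {q = q} 1≤q refl = HasCount-1
  (gaps₃-InF (admissible 1≤q 1≤q (n≤2*n q) (n≤1+2*n q)) (sym (2*-≡-+ q)) (⊔-idem q))
  (λ {G} inF → [ proj₂ , proj₂ ]′ (InF₃-pairs (subst (λ g → InF g q 3 G) (2*-≡-+ q) inF)))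

count-between : ∀ {g q} → 1 ≤ q → g + 1 ≤ 2 * q → 3 * q ≤ 2 * g → HasCount (InF g q 3) 2
count-between {g} {q} 1≤q g+1≤2q 3q≤2g with m≤n⇒∃[o]m+o≡n {q} {g} (3q≤2g⇒q≤g 3q≤2g)
... | b , refl = HasCount-2 (<⇒≱ b<q ∘ gaps₃-≡⇒≤)
  (gaps₃-InF (admissible 1≤q 1≤b (≤-trans (<⇒≤ b<q) (n≤2*n q)) (≤-trans q≤2b (n≤1+n _)))
    refl (m≥n⇒m⊔n≡m (<⇒≤ b<q)))
  (gaps₃-InF (admissible 1≤b 1≤q q≤2b (≤-trans (<⇒≤ b<q) (n≤1+2*n q)))
    (+-comm b q) (m≤n⇒m⊔n≡n (<⇒≤ b<q)))
  (Sum.map proj₂ proj₂ ∘ InF₃-pairs)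
  where
  b<q : b < q
  b<q = q+b<2q⇒b<q g+1≤2q
  q≤2b : q ≤ 2 * b
  q≤2b = 3q≤2[q+b]⇒q≤2b 3q≤2g
  1≤b : 1 ≤ b
  1≤b = n≢0⇒n>0 λ { refl → <⇒≱ 1≤q q≤2b }

count-3q≡2g+1 : ∀ {g q} → 2 ≤ g → 3 * q ≡ 2 * g + 1 → HasCount (InF g q 3) 1
count-3q≡2g+1 {g} {q} 2≤g 3q≡2g+1
  with m≤n⇒∃[o]m+o≡n {q} {g} (3q≡2g+1⇒q≤g (≤-trans (n≤1+n 1) 2≤g) 3q≡2g+1)
... | b , refl with 3q≡2[q+b]+1⇒q≡1+2b {q} {b} 3q≡2g+1
... | refl = HasCount-1
  (gaps₃-InF (admissible z<s 1≤b (≤-trans (n≤1+2*n b) (n≤2*n _)) ≤-refl)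
    refl (m≥n⇒m⊔n≡m (n≤1+2*n b)))
  λ inF → case InF₃-pairs inF of λ where
    (inj₁ (_ , G≡gaps₃))                 → G≡gaps₃
    (inj₂ (admissible _ _ 1+2b≤2b _ , _)) → ⊥-elim (<-irrefl refl 1+2b≤2b)
  where
  1≤b : 1 ≤ b
  1≤b = n≢0⇒n>0 λ { refl → <⇒≱ 2≤g ≤-refl }

count-2g+1<3q : ∀ {g q} → 2 * g + 1 < 3 * q → HasCount (InF g q 3) 0
count-2g+1<3q {g} {q} 2g+1<3q = HasCount-0 λ inF →
  let _ , _ , adm , a+b≡g , a⊔b≡q , _ = InF₃-classification {g} {q} inF
  in <⇒≱ 2g+1<3q
       (subst₂ (λ s m → 3 * m ≤ 2 * s + 1) a+b≡g a⊔b≡q (Admissible⇒3[a⊔b]≤2[a+b]+1 adm))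

theorem7p1 : (g q : ℕ) → 2 ≤ g → 1 ≤ q →
      ((2 * q < g) → HasCount (InF g q 3) 0)
    × ((2 * q ≡ g) → HasCount (InF g q 3) 1)
    × ((g + 1 ≤ 2 * q) → (3 * q ≤ 2 * g) → HasCount (InF g q 3) 2)
    × ((3 * q ≡ 2 * g + 1) → HasCount (InF g q 3) 1)
    × ((2 * g + 1 < 3 * q) → HasCount (InF g q 3) 0)
theorem7p1 g q 2≤g 1≤q =
    count-2q<g {g} {q} , count-2q≡g 1≤q , count-between 1≤q , count-3q≡2g+1 {g} {q} 2≤g
  , count-2g+1<3q {g} {q}
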